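{- For every integer $b>509203$ there exist infinitely many $b$-repdigits that are Riesel numbers.
   Context: For integers $b\ge2$, $1\le k<b$, $t\ge1$, the $b$-repdigit $k_b^{(t)}$ is $k(b^t-1)/(b-1)$, the digit $k$ repeated $t$ times in base $b$. A Riesel number is an odd positive integer $k$ such that $k\cdot 2^n-1$ is composite for all positive integers $n$. -}

module Defs where

open import Data.Nat using (ℕ; zero; suc; _+_; _*_; _∸_; _^_; _≤_; _<_)
open import Data.Nat.Primality using (Composite)
open import Data.Nat.Divisibility using (_∤_)
open import Data.Product using (_×_; ∃)
open import Relation.Binary.PropositionalEquality using (_≡_)

-- repunit b t = 1 + b + ... + b^(t-1) = (b^t - 1)/(b - 1)  (for b ≥ 2)
repunit : ℕ → ℕ → ℕ
repunit b zero    = 0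
repunit b (suc t) = 1 + b * repunit b t

repdigit : ℕ → ℕ → ℕ → ℕ
repdigit b k t = k * repunit b t

IsRiesel : ℕ → Set
IsRiesel k = (2 ∤ k) × (1 ≤ k) × ((n : ℕ) → 1 ≤ n → Composite (k * 2 ^ n ∸ 1))

IsRepdigit : ℕ → ℕ → Set
IsRepdigit b m = ∃ λ k → ∃ λ t →
  (1 ≤ k) × (k < b) × (1 ≤ t) × (repdigit b k t ≡ m)

{-# OPTIONS --safe #-}
-- K = 509203 is a Riesel number with covering set {3, 5, 7, 13, 17, 241}: 2^24 ≡ 1
-- modulo each of these primes, and for every residue r of n modulo 24 one of them
-- divides K·2^r − 1, hence K·2^n − 1.  If R ≡ 1 modulo 2 and modulo every covering
-- prime, then K·R is odd and K·R·2^n − 1 ≡ K·2^n − 1 modulo the same primes, so K·R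
-- is Riesel too.  By Fermat, the repunit R_b(1 + t) ≡ 1 (mod p) whenever p(p − 1) ∣ t,
-- so R = R_b(1 + N·L) with L = lcm p(p − 1) qualifies, and K·R is a b-repdigit once b > K.
module Submission where

open import Defs
open import Data.Nat using (ℕ; _<_; _≤_)
open import Data.Product using (∃; _×_)

open import Data.Nat
  using (zero; suc; _+_; _*_; _∸_; _^_; _%_; _/_; _<?_; NonZero; z≤n; s≤s; z<s; s<s;
         >-nonZero; n>1⇒nonTrivial; allUpTo?)
open import Data.Nat.Properties
open import Algebra.Properties.CommutativeSemigroup *-commutativeSemigroup
  using (x∙yz≈y∙xz; xy∙z≈xz∙y)
open import Data.Nat.DivMod using (%-distribˡ-+; %-distribˡ-*; m%n%n≡m%n; m%n<n; m≡m%n+[m/n]*n)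
open import Data.Nat.Divisibility
  using (_∣_; _∤_; _∣?_; divides; _∣0; ∣-trans; ∣m∣n⇒∣m+n; ∣m+n∣m⇒∣n; ∣m⇒∣m*n; ∣n⇒∣m*n;
         m∣m*n; n∣m*n; ∣1⇒≡1; n∣m⇒m%n≡0; m%n≡0⇒n∣m; hasNonTrivialDivisor)
open import Data.Nat.Primality using (Composite)
open import Data.List using (List; []; _∷_)
open import Data.List.Relation.Unary.All as All using (All; _∷_)
open import Data.List.Relation.Unary.Any as Any using (Any)
open import Data.Product using (_,_)
open import Data.Sum using (_⊎_; inj₁; inj₂)
open import Relation.Nullary.Decidable using (Dec; from-yes; _×-dec_; _⊎-dec_)
open import Relation.Binary.PropositionalEquality
  using (_≡_; refl; sym; trans; cong; cong₂; subst; module ≡-Reasoning)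

-- d ∣ m ∸ 1 reads m ≡ 1 (mod d), except that m = 0 satisfies it too.
∣m∸1∣n∸1⇒∣m*n∸1 : ∀ {d} m n → d ∣ m ∸ 1 → d ∣ n ∸ 1 → d ∣ m * n ∸ 1
∣m∸1∣n∸1⇒∣m*n∸1 {d} zero    n       _   _   = d ∣0
∣m∸1∣n∸1⇒∣m*n∸1 {d} (suc m) zero    _   _   =
  subst (λ x → d ∣ x ∸ 1) (sym (*-zeroʳ (suc m))) (d ∣0)
∣m∸1∣n∸1⇒∣m*n∸1     (suc m) (suc n) d∣m d∣n = ∣m∣n⇒∣m+n d∣n (∣m⇒∣m*n (suc n) d∣m)

∣m∸1⇒∣m^n∸1 : ∀ {d} m n → d ∣ m ∸ 1 → d ∣ m ^ n ∸ 1
∣m∸1⇒∣m^n∸1 {d} m zero    _   = d ∣0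
∣m∸1⇒∣m^n∸1     m (suc n) d∣m = ∣m∸1∣n∸1⇒∣m*n∸1 m (m ^ n) d∣m (∣m∸1⇒∣m^n∸1 m n d∣m)

∣m∸1⇒∤m : ∀ {d m} → 1 < d → 0 < m → d ∣ m ∸ 1 → d ∤ m
∣m∸1⇒∤m {d} {suc m} 1<d _ d∣m d∣1+m =
  <⇒≢ 1<d (sym (∣1⇒≡1 (∣m+n∣m⇒∣n (subst (d ∣_) (+-comm 1 m) d∣1+m) d∣m)))

∣m*x^[n%e]∸1⇒∣m*x^n∸1 : ∀ {d} m x e .{{_ : NonZero e}} n →
  d ∣ x ^ e ∸ 1 → d ∣ m * x ^ (n % e) ∸ 1 → d ∣ m * x ^ n ∸ 1
∣m*x^[n%e]∸1⇒∣m*x^n∸1 {d} m x e n d∣x^e∸1 d∣mx^r∸1 =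
  subst (λ y → d ∣ y ∸ 1) split
    (∣m∸1∣n∸1⇒∣m*n∸1 (m * x ^ (n % e)) ((x ^ e) ^ (n / e))
      d∣mx^r∸1 (∣m∸1⇒∣m^n∸1 (x ^ e) (n / e) d∣x^e∸1))
  where
  open ≡-Reasoning
  split : m * x ^ (n % e) * (x ^ e) ^ (n / e) ≡ m * x ^ n
  split = begin
    m * x ^ (n % e) * (x ^ e) ^ (n / e)   ≡⟨ *-assoc m _ _ ⟩
    m * (x ^ (n % e) * (x ^ e) ^ (n / e))
      ≡⟨ cong (λ y → m * (x ^ (n % e) * y)) (^-*-assoc x e (n / e)) ⟩
    m * (x ^ (n % e) * x ^ (e * (n / e))) ≡⟨ cong (m *_) (^-distribˡ-+-* x (n % e) _) ⟨
    m * x ^ (n % e + e * (n / e))         ≡⟨ cong (λ y → m * x ^ (n % e + y)) (*-comm e (n / e)) ⟩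
    m * x ^ (n % e + n / e * e)           ≡⟨ cong (λ y → m * x ^ y) (m≡m%n+[m/n]*n n e) ⟨
    m * x ^ n                             ∎

repunit-+ : ∀ b m n → repunit b (m + n) ≡ repunit b m + b ^ m * repunit b n
repunit-+ b zero    n = sym (*-identityˡ (repunit b n))
repunit-+ b (suc m) n = cong suc (begin
    b * repunit b (m + n)                       ≡⟨ cong (b *_) (repunit-+ b m n) ⟩
    b * (repunit b m + b ^ m * repunit b n)     ≡⟨ *-distribˡ-+ b _ _ ⟩
    b * repunit b m + b * (b ^ m * repunit b n) ≡⟨ cong (b * repunit b m +_) (*-assoc b _ _) ⟨
    b * repunit b m + b * b ^ m * repunit b n   ∎)
  where open ≡-Reasoning

n≤repunit : ∀ b .{{_ : NonZero b}} n → n ≤ repunit b n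
n≤repunit b zero    = z≤n
n≤repunit b (suc n) = s≤s (≤-trans (n≤repunit b n) (m≤n*m (repunit b n) b))

∣*repunit-periodic : ∀ {p} b d {t} → p ∣ b * repunit b d → d ∣ t → p ∣ b * repunit b t
∣*repunit-periodic {p} b d p∣bR[d] (divides j refl) = multiples j
  where
  multiples : ∀ j → p ∣ b * repunit b (j * d)
  multiples zero    = subst (p ∣_) (sym (*-zeroʳ b)) (p ∣0)
  multiples (suc j) =
    subst (p ∣_) (sym split) (∣m∣n⇒∣m+n p∣bR[d] (∣n⇒∣m*n (b ^ d) (multiples j)))
    where
    open ≡-Reasoning
    split : b * repunit b (d + j * d) ≡ b * repunit b d + b ^ d * (b * repunit b (j * d))
    split = begin
      b * repunit b (d + j * d)                           ≡⟨ cong (b *_) (repunit-+ b d (j * d)) ⟩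
      b * (repunit b d + b ^ d * repunit b (j * d))       ≡⟨ *-distribˡ-+ b _ _ ⟩
      b * repunit b d + b * (b ^ d * repunit b (j * d))
        ≡⟨ cong (b * repunit b d +_) (x∙yz≈y∙xz b (b ^ d) (repunit b (j * d))) ⟩
      b * repunit b d + b ^ d * (b * repunit b (j * d))   ∎

module _ {p : ℕ} .{{_ : NonZero p}} where

  %-cong-+ : ∀ {a b c d} → a % p ≡ b % p → c % p ≡ d % p → (a + c) % p ≡ (b + d) % p
  %-cong-+ {a} {b} {c} {d} a≡b c≡d = begin
    (a + c) % p         ≡⟨ %-distribˡ-+ a c p ⟩
    (a % p + c % p) % p ≡⟨ cong₂ (λ x y → (x + y) % p) a≡b c≡d ⟩
    (b % p + d % p) % p ≡⟨ %-distribˡ-+ b d p ⟨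
    (b + d) % p         ∎
    where open ≡-Reasoning

  %-cong-* : ∀ {a b c d} → a % p ≡ b % p → c % p ≡ d % p → (a * c) % p ≡ (b * d) % p
  %-cong-* {a} {b} {c} {d} a≡b c≡d = begin
    (a * c) % p           ≡⟨ %-distribˡ-* a c p ⟩
    (a % p * (c % p)) % p ≡⟨ cong₂ (λ x y → (x * y) % p) a≡b c≡d ⟩
    (b % p * (d % p)) % p ≡⟨ %-distribˡ-* b d p ⟨
    (b * d) % p           ∎
    where open ≡-Reasoning

  repunit-cong-% : ∀ {b c} → b % p ≡ c % p → ∀ t → repunit b t % p ≡ repunit c t % p
  repunit-cong-% b≡c zero    = refl
  repunit-cong-% b≡c (suc t) = %-cong-+ {1} {1} refl (%-cong-* b≡c (repunit-cong-% b≡c t))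

  ∣*repunit-cong : ∀ {b c} → b % p ≡ c % p → ∀ t → p ∣ c * repunit c t → p ∣ b * repunit b t
  ∣*repunit-cong b≡c t p∣cR =
    m%n≡0⇒n∣m _ p (trans (%-cong-* b≡c (repunit-cong-% b≡c t)) (n∣m⇒m%n≡0 _ p p∣cR))

-- For prime p this is Fermat's little theorem (first disjunct when c ≢ 1 (mod p),
-- second when c ≡ 1); here it is verified by computation.
RepunitsPeriodicMod : ℕ → Set
RepunitsPeriodicMod p = ∀ {c} → c < p → p ∣ c * repunit c (p ∸ 1) ⊎ p ∣ c * repunit c p

repunitsPeriodicMod? : ∀ p → Dec (RepunitsPeriodicMod p)
repunitsPeriodicMod? p =
  allUpTo? (λ c → (p ∣? c * repunit c (p ∸ 1)) ⊎-dec (p ∣? c * repunit c p)) p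

∣repunit[1+t]∸1 : ∀ {p} .{{_ : NonZero p}} → RepunitsPeriodicMod p →
  ∀ b t → p * (p ∸ 1) ∣ t → p ∣ repunit b (suc t) ∸ 1
∣repunit[1+t]∸1 {p} periodic b t p[p∸1]∣t =
  ∣*repunit-cong (sym (m%n%n≡m%n b p)) t (extend (periodic (m%n<n b p)))
  where
  c = b % p
  extend : p ∣ c * repunit c (p ∸ 1) ⊎ p ∣ c * repunit c p → p ∣ c * repunit c t
  extend (inj₁ p∣) = ∣*repunit-periodic c (p ∸ 1) p∣ (∣-trans (n∣m*n p) p[p∸1]∣t)
  extend (inj₂ p∣) = ∣*repunit-periodic c p p∣ (∣-trans (m∣m*n (p ∸ 1)) p[p∸1]∣t)

record RieselCovering (k e : ℕ) (ps : List ℕ) : Set where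
  field
    bounded : All (λ p → 1 < p × p < k ∸ 1) ps
    order∣  : All (λ p → p ∣ 2 ^ e ∸ 1) ps
    covers  : ∀ {r} → r < e → Any (λ p → p ∣ k * 2 ^ r ∸ 1) ps

covering⇒composite : ∀ {k e ps} .{{_ : NonZero e}} → RieselCovering k e ps →
  ∀ R .{{_ : NonZero R}} → All (λ p → p ∣ R ∸ 1) ps → ∀ n → Composite (k * R * 2 ^ n ∸ 1)
covering⇒composite {k} {e} cov R ps∣R∸1 n =
  byCoveringPrime
    (All.lookupAny (All.zip (bounded , All.zip (order∣ , ps∣R∸1))) (covers (m%n<n n e)))
  where
  open RieselCovering cov
  k≤X : k ≤ k * R * 2 ^ n
  k≤X = ≤-trans (m≤m*n k R) (m≤m*n (k * R) (2 ^ n) {{m^n≢0 2 n}})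
  byCoveringPrime : ∀ {p} →
    ((1 < p × p < k ∸ 1) × p ∣ 2 ^ e ∸ 1 × p ∣ R ∸ 1) × p ∣ k * 2 ^ (n % e) ∸ 1 →
    Composite (k * R * 2 ^ n ∸ 1)
  byCoveringPrime {p} (((1<p , p<k∸1) , p∣2^e∸1 , p∣R∸1) , p∣k2^r∸1) =
    hasNonTrivialDivisor {{n>1⇒nonTrivial 1<p}} (<-≤-trans p<k∸1 (∸-monoˡ-≤ 1 k≤X))
      (subst (λ x → p ∣ x ∸ 1) (xy∙z≈xz∙y k (2 ^ n) R)
        (∣m∸1∣n∸1⇒∣m*n∸1 (k * 2 ^ n) R (∣m*x^[n%e]∸1⇒∣m*x^n∸1 k 2 e n p∣2^e∸1 p∣k2^r∸1) p∣R∸1))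

K : ℕ
K = 509203

coveringPrimes : List ℕ
coveringPrimes = 3 ∷ 5 ∷ 7 ∷ 13 ∷ 17 ∷ 241 ∷ []

K-covering : RieselCovering K 24 coveringPrimes
K-covering = record
  { bounded = from-yes (All.all? (λ p → (1 <? p) ×-dec (p <? K ∸ 1)) coveringPrimes)
  ; order∣  = from-yes (All.all? (λ p → p ∣? 2 ^ 24 ∸ 1) coveringPrimes)
  ; covers  = from-yes (allUpTo? (λ r → Any.any? (λ p → p ∣? K * 2 ^ r ∸ 1) coveringPrimes) 24)
  }

-- lcm of p (p − 1) over p ∈ 2 ∷ coveringPrimes
L : ℕ
L = 89478480

2∷coveringPrimes∣repunit∸1 : ∀ b t → L ∣ t →
  All (λ p → p ∣ repunit b (suc t) ∸ 1) (2 ∷ coveringPrimes)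
2∷coveringPrimes∣repunit∸1 b t L∣t = All.map
  (λ (0<p , periodic , p[p∸1]∣L) →
     ∣repunit[1+t]∸1 {{>-nonZero 0<p}} periodic b t (∣-trans p[p∸1]∣L L∣t))
  (from-yes (All.all? (λ p → (0 <? p) ×-dec repunitsPeriodicMod? p ×-dec (p * (p ∸ 1) ∣? L))
                      (2 ∷ coveringPrimes)))

repdigit-isRiesel : ∀ b t → L ∣ t → IsRiesel (repdigit b K (suc t))
repdigit-isRiesel b t L∣t = riesel (2∷coveringPrimes∣repunit∸1 b t L∣t)
  where
  R = repunit b (suc t)
  0<KR : 0 < K * R
  0<KR = ≤-trans z<s (m≤m*n K R)
  riesel : All (λ p → p ∣ R ∸ 1) (2 ∷ coveringPrimes) → IsRiesel (K * R)
  riesel (2∣R∸1 ∷ ps∣R∸1) =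
    ∣m∸1⇒∤m (s<s z<s) 0<KR (∣m∸1∣n∸1⇒∣m*n∸1 K R (divides 254601 refl) 2∣R∸1) ,
    0<KR ,
    λ n _ → covering⇒composite K-covering R ps∣R∸1 n

corollary3p8 : (b : ℕ) → 509203 < b →
    (N : ℕ) → ∃ λ m → (N ≤ m) × IsRepdigit b m × IsRiesel m
corollary3p8 b K<b N =
  repdigit b K t , N≤repdigit , (K , t , z<s , K<b , z<s , refl) ,
  repdigit-isRiesel b (N * L) (n∣m*n N)
  where
  instance _ = >-nonZero (<-trans z<s K<b)
  t = suc (N * L)
  N≤repdigit : N ≤ repdigit b K t
  N≤repdigit = begin
    N               ≤⟨ m≤m*n N L ⟩
    N * L           ≤⟨ n≤1+n (N * L) ⟩
    t               ≤⟨ n≤repunit b t ⟩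
    repunit b t     ≤⟨ m≤n*m (repunit b t) K ⟩
    K * repunit b t ∎
    where open ≤-Reasoning
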